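{- Let $R$ be $\mathbb{Z}$ or $\mathbb{Z}[i]$, and let $A\in R^{n\times n}$ be an $n$-icube of norm $\lambda$ (i.e. $A^*A=\lambda I$, $\lambda>0$) with Smith normal form $\mathrm{diag}(\alpha_1,\dots,\alpha_n)$. Then $\overline{\alpha_j}\,\alpha_{n+1-j}=\lambda$ for all $1\leq j\leq n$.
   Context: $A^*=\overline{A}^T$. The Smith normal form of $A$ is $\mathrm{diag}(\alpha_1,\dots,\alpha_n)$ if $A\in\mathrm{GL}_n(R)\,\mathrm{diag}(\alpha_1,\dots,\alpha_n)\,\mathrm{GL}_n(R)$ with $\alpha_1\mid\alpha_2\mid\dots\mid\alpha_n$ and the normalization $\alpha_j>0$ if $R=\mathbb{Z}$, respectively $\mathrm{Re}\,\alpha_j>0$, $\mathrm{Im}\,\alpha_j\geq0$ if $R=\mathbb{Z}[i]$. -}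

module Defs where

open import Data.Nat as ℕ using (ℕ; zero; suc)
open import Data.Integer as ℤ using (ℤ; +_; 0ℤ; 1ℤ)
open import Data.Fin as Fin using (Fin; toℕ)
open import Data.Product using (Σ; ∃; _×_; _,_)
open import Relation.Binary.PropositionalEquality using (_≡_)
open import Relation.Nullary using (yes; no)

record ℤ[i] : Set where
  constructor _+_i
  field
    re : ℤ
    im : ℤ
open ℤ[i] public

module G where
  _+_ : ℤ[i] → ℤ[i] → ℤ[i]
  (a + b i) + (c + d i) = (a ℤ.+ c) + (b ℤ.+ d) i

  _*_ : ℤ[i] → ℤ[i] → ℤ[i]
  (a + b i) * (c + d i) = (a ℤ.* c ℤ.- b ℤ.* d) + (a ℤ.* d ℤ.+ b ℤ.* c) i

  conj : ℤ[i] → ℤ[i]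
  conj (a + b i) = a + (ℤ.- b) i

  0# 1# : ℤ[i]
  0# = 0ℤ + 0ℤ i
  1# = 1ℤ + 0ℤ i

  fromℕ : ℕ → ℤ[i]
  fromℕ m = (+ m) + 0ℤ i

  Normalized : ℤ[i] → Set
  Normalized α = (0ℤ ℤ.< re α) × (0ℤ ℤ.≤ im α)

data Ring : Set where
  `ℤ `ℤ[i] : Ring

Carrier : Ring → Set
Carrier `ℤ    = ℤ
Carrier `ℤ[i] = ℤ[i]

add mul : (R : Ring) → Carrier R → Carrier R → Carrier R
add `ℤ    = ℤ._+_
add `ℤ[i] = G._+_
mul `ℤ    = ℤ._*_
mul `ℤ[i] = G._*_

conj : (R : Ring) → Carrier R → Carrier R
conj `ℤ    x = x
conj `ℤ[i] x = G.conj x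

zeroR oneR : (R : Ring) → Carrier R
zeroR `ℤ    = 0ℤ
zeroR `ℤ[i] = G.0#
oneR `ℤ    = 1ℤ
oneR `ℤ[i] = G.1#

ι : (R : Ring) → ℕ → Carrier R
ι `ℤ    m = + m
ι `ℤ[i] m = G.fromℕ m

Normalized : (R : Ring) → Carrier R → Set
Normalized `ℤ    α = 0ℤ ℤ.< α
Normalized `ℤ[i] α = G.Normalized α

module _ (R : Ring) where
  _∣R_ : Carrier R → Carrier R → Set
  a ∣R b = ∃ λ c → b ≡ mul R c a

  Mat : ℕ → Set
  Mat n = Fin n → Fin n → Carrier R

  sumFin : ∀ {n} → (Fin n → Carrier R) → Carrier R
  sumFin {zero}  f = zeroR R
  sumFin {suc n} f = add R (f Fin.zero) (sumFin (λ k → f (Fin.suc k)))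

  _⊗_ : ∀ {n} → Mat n → Mat n → Mat n
  _⊗_ A B = λ r s → sumFin (λ k → mul R (A r k) (B k s))

  _* : ∀ {n} → Mat n → Mat n
  _* A = λ r s → conj R (A s r)

  diag : ∀ {n} → (Fin n → Carrier R) → Mat n
  diag α r s with r Fin.≟ s
  ... | yes _ = α r
  ... | no  _ = zeroR R

  I : ∀ {n} → Mat n
  I = diag (λ _ → oneR R)

  scal : ∀ {n} → ℕ → Mat n
  scal l = diag (λ _ → ι R l)

  _≐_ : ∀ {n} → Mat n → Mat n → Set
  A ≐ B = ∀ r s → A r s ≡ B r s

  InGL : ∀ {n} → Mat n → Set
  InGL {n} P = Σ (Mat n) λ Q → ((P ⊗ Q) ≐ I) × ((Q ⊗ P) ≐ I)

  IsIcube : ∀ {n} → Mat n → ℕ → Set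
  IsIcube A l = (0 ℕ.< l) × (((A *) ⊗ A) ≐ scal l)

  IsSNF : ∀ {n} → Mat n → (Fin n → Carrier R) → Set
  IsSNF {n} A α =
      (Σ (Mat n) λ P → Σ (Mat n) λ Q →
         InGL P × InGL Q × (A ≐ ((P ⊗ diag α) ⊗ Q)))
    × (∀ (r s : Fin n) → toℕ s ≡ suc (toℕ r) → α r ∣R α s)
    × (∀ (r : Fin n) → Normalized R (α r))

{-# OPTIONS --safe #-}
-- Write A = P D Q with D = diag α and P, Q invertible, and let M = Pᴴ P and N = (Q⁻¹)ᴴ Q⁻¹,
-- both invertible. Then Aᴴ A = λ I becomes Dᴴ M D = λ N, i.e. conj(α r) M r s α s = λ N r s.
-- Fix j, let k = n + 1 - j and γ = conj(α j) α k. Along the divisor chain, conj(α r) α s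
-- divides γ for r ≤ j and s ≤ k, so λ ∣ γ M r s on the top-left j × k block of M; dually
-- γ ∣ λ N r s on the bottom-right k × j block of N.
-- An invertible n × n matrix with an a × b block inside an ideal J, where a + b > n, forces
-- 1 ∈ J: on the a block rows, M M⁻¹ = I factors the identity of size a modulo J through the
-- n - b < a remaining columns, and Gaussian elimination shows that 1 is then nilpotent
-- modulo J. For the ideals {x | λ ∣ γ x} and {x | γ ∣ λ x} this makes γ and λ associates,
-- and the normalisation of the Smith invariants (Re γ > 0, λ > 0) leaves only γ = λ.
module Submission where

open import Algebra.Bundles using (CommutativeRing)
open import Algebra.Consequences.Propositional using (comm∧idˡ⇒id; comm∧invˡ⇒inv; comm∧distrʳ⇒distrˡ)
import Algebra.Solver.Ring
import Algebra.Solver.Ring.AlmostCommutativeRing as Almost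
open import Algebra.Structures using (IsCommutativeRing)
open import Data.Fin as Fin using (Fin; zero; suc; toℕ; opposite; punchIn; _↑ˡ_; _↑ʳ_)
import Data.Fin.Permutation as Perm
import Data.Fin.Properties as FinP
open import Data.Integer as ℤ using (ℤ; 0ℤ; 1ℤ; ∣_∣)
import Data.Integer.Properties as ℤP
open import Data.Integer.Tactic.RingSolver using (solve-∀)
import Data.Maybe as Maybe
open import Data.Nat as ℕ using (ℕ; zero; suc)
import Data.Nat.Divisibility as ℕ∣
import Data.Nat.Properties as ℕP
open import Data.Product using (_,_; ∃; ∃₂)
import Data.Sum as Sum
open import Defs as D hiding (_⊗_; _*; diag; I; _≐_)
open import Function using (_∘_)
open import Level using (0ℓ)
open import Relation.Binary.Bundles using (Setoid)
open import Relation.Binary.PropositionalEquality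
import Relation.Binary.Reasoning.Setoid as SetoidReasoning
open import Relation.Nullary using (Dec; yes; no; contradiction)
open import Relation.Nullary.Decidable using (dec⇒maybe)

opposite-injective : ∀ {n} {r s : Fin n} → opposite r ≡ opposite s → r ≡ s
opposite-injective {r = r} {s} eq =
  trans (sym (FinP.opposite-involutive r)) (trans (cong opposite eq) (FinP.opposite-involutive s))

toℕ-opposite-+ : ∀ {n} (j : Fin n) → toℕ (opposite j) ℕ.+ suc (toℕ j) ≡ n
toℕ-opposite-+ j = trans (cong (ℕ._+ suc (toℕ j)) (FinP.opposite-prop j)) (ℕP.m∸n+n≡m (FinP.toℕ<n j))

opposite-≤-swap : ∀ {n} {r j : Fin n} → toℕ r ℕ.≤ toℕ (opposite j) → toℕ j ℕ.≤ toℕ (opposite r)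
opposite-≤-swap {n} {r} {j} r≤k =
  subst (toℕ j ℕ.≤_) (sym (FinP.opposite-prop r)) (ℕP.m+n≤o⇒m≤o∸n (toℕ j) j+r<n)
  where
  r+j<n : toℕ r ℕ.+ suc (toℕ j) ℕ.≤ n
  r+j<n = ℕP.m≤o∸n⇒m+n≤o (toℕ r) (FinP.toℕ<n j) (subst (toℕ r ℕ.≤_) (FinP.opposite-prop j) r≤k)
  j+r<n : toℕ j ℕ.+ suc (toℕ r) ℕ.≤ n
  j+r<n = subst (ℕ._≤ n) (trans (ℕP.+-suc (toℕ r) (toℕ j)) (ℕP.+-comm (suc (toℕ r)) (toℕ j))) r+j<n

opposite-antitone : ∀ {n} {r s : Fin n} → toℕ r ℕ.≤ toℕ s → toℕ (opposite s) ℕ.≤ toℕ (opposite r)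
opposite-antitone {r = r} {s} r≤s =
  opposite-≤-swap (subst (toℕ r ℕ.≤_) (cong toℕ (sym (FinP.opposite-involutive s))) r≤s)

-- Gaussian integers

private
  module Coordinates where
    open import Data.Integer.Base using (_+_; _*_; _-_; -_)

    *-comm-re : ∀ a b c d → a * c - b * d ≡ c * a - d * b
    *-comm-re = solve-∀
    *-comm-im : ∀ a b c d → a * d + b * c ≡ c * b + d * a
    *-comm-im = solve-∀
    *-assoc-re : ∀ a b c d e f → (a * c - b * d) * e - (a * d + b * c) * f ≡ a * (c * e - d * f) - b * (c * f + d * e)
    *-assoc-re = solve-∀
    *-assoc-im : ∀ a b c d e f → (a * c - b * d) * f + (a * d + b * c) * e ≡ a * (c * f + d * e) + b * (c * e - d * f)
    *-assoc-im = solve-∀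
    *-identityˡ-re : ∀ a b → 1ℤ * a - 0ℤ * b ≡ a
    *-identityˡ-re = solve-∀
    *-identityˡ-im : ∀ a b → 1ℤ * b + 0ℤ * a ≡ b
    *-identityˡ-im = solve-∀
    distribʳ-re : ∀ a b c d e f → (c + e) * a - (d + f) * b ≡ (c * a - d * b) + (e * a - f * b)
    distribʳ-re = solve-∀
    distribʳ-im : ∀ a b c d e f → (c + e) * b + (d + f) * a ≡ (c * b + d * a) + (e * b + f * a)
    distribʳ-im = solve-∀
    conj-*-re : ∀ a b c d → a * c - b * d ≡ a * c - (- b) * (- d)
    conj-*-re = solve-∀
    conj-*-im : ∀ a b c d → - (a * d + b * c) ≡ a * (- d) + (- b) * c
    conj-*-im = solve-∀
    re-conj-* : ∀ a b c d → a * c - (- b) * d ≡ a * c + b * d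
    re-conj-* = solve-∀
    norm-* : ∀ a b c d →
      (a * c - b * d) * (a * c - b * d) + (a * d + b * c) * (a * d + b * c) ≡ (a * a + b * b) * (c * c + d * d)
    norm-* = solve-∀
    *-real-re : ∀ a b l → a * l - b * 0ℤ ≡ a * l
    *-real-re = solve-∀
    *-real-im : ∀ a b l → a * 0ℤ + b * l ≡ b * l
    *-real-im = solve-∀
    real-*-re : ∀ a b → a * b ≡ a * b - 0ℤ * 0ℤ
    real-*-re = solve-∀
    real-*-im : ∀ a b → 0ℤ ≡ a * 0ℤ + 0ℤ * b
    real-*-im = solve-∀

module Gaussian where
  open G

  -_ : ℤ[i] → ℤ[i]
  - (a + b i) = (ℤ.- a) + (ℤ.- b) i

  +-assoc : ∀ x y z → (x + y) + z ≡ x + (y + z)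
  +-assoc (a + b i) (c + d i) (e + f i) = cong₂ _+_i (ℤP.+-assoc a c e) (ℤP.+-assoc b d f)

  +-comm : ∀ x y → x + y ≡ y + x
  +-comm (a + b i) (c + d i) = cong₂ _+_i (ℤP.+-comm a c) (ℤP.+-comm b d)

  +-identityˡ : ∀ x → 0# + x ≡ x
  +-identityˡ (a + b i) = cong₂ _+_i (ℤP.+-identityˡ a) (ℤP.+-identityˡ b)

  -‿inverseˡ : ∀ x → (- x) + x ≡ 0#
  -‿inverseˡ (a + b i) = cong₂ _+_i (ℤP.+-inverseˡ a) (ℤP.+-inverseˡ b)

  *-comm : ∀ x y → x * y ≡ y * x
  *-comm (a + b i) (c + d i) = cong₂ _+_i (Coordinates.*-comm-re a b c d) (Coordinates.*-comm-im a b c d)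

  *-assoc : ∀ x y z → (x * y) * z ≡ x * (y * z)
  *-assoc (a + b i) (c + d i) (e + f i) =
    cong₂ _+_i (Coordinates.*-assoc-re a b c d e f) (Coordinates.*-assoc-im a b c d e f)

  *-identityˡ : ∀ x → 1# * x ≡ x
  *-identityˡ (a + b i) = cong₂ _+_i (Coordinates.*-identityˡ-re a b) (Coordinates.*-identityˡ-im a b)

  distribʳ : ∀ x y z → (y + z) * x ≡ (y * x) + (z * x)
  distribʳ (a + b i) (c + d i) (e + f i) =
    cong₂ _+_i (Coordinates.distribʳ-re a b c d e f) (Coordinates.distribʳ-im a b c d e f)

  isCommutativeRing : IsCommutativeRing _≡_ _+_ _*_ -_ 0# 1#
  isCommutativeRing = record
    { isRing = record
      { +-isAbelianGroup = record
        { isGroup = record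
          { isMonoid = record
            { isSemigroup = record
              { isMagma = record { isEquivalence = isEquivalence ; ∙-cong = cong₂ _+_ }
              ; assoc = +-assoc }
            ; identity = comm∧idˡ⇒id +-comm +-identityˡ }
          ; inverse = comm∧invˡ⇒inv +-comm -‿inverseˡ
          ; ⁻¹-cong = cong -_ }
        ; comm = +-comm }
      ; *-cong = cong₂ _*_
      ; *-assoc = *-assoc
      ; *-identity = comm∧idˡ⇒id *-comm *-identityˡ
      ; distrib = comm∧distrʳ⇒distrˡ *-comm distribʳ , distribʳ }
    ; *-comm = *-comm }

  norm : ℤ[i] → ℕ
  norm (a + b i) = ∣ a ∣ ℕ.* ∣ a ∣ ℕ.+ ∣ b ∣ ℕ.* ∣ b ∣

  norm-* : ∀ x y → norm (x * y) ≡ norm x ℕ.* norm y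
  norm-* (a + b i) (c + d i) = ℤP.+-injective (begin
    ℤ.+ norm ((a + b i) * (c + d i))
      ≡⟨ +norm (a ℤ.* c ℤ.- b ℤ.* d) (a ℤ.* d ℤ.+ b ℤ.* c) ⟩
    (a ℤ.* c ℤ.- b ℤ.* d) ℤ.* (a ℤ.* c ℤ.- b ℤ.* d) ℤ.+ (a ℤ.* d ℤ.+ b ℤ.* c) ℤ.* (a ℤ.* d ℤ.+ b ℤ.* c)
      ≡⟨ Coordinates.norm-* a b c d ⟩
    (a ℤ.* a ℤ.+ b ℤ.* b) ℤ.* (c ℤ.* c ℤ.+ d ℤ.* d)
      ≡⟨ cong₂ ℤ._*_ (+norm a b) (+norm c d) ⟨
    ℤ.+ norm (a + b i) ℤ.* ℤ.+ norm (c + d i)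
      ≡⟨ ℤP.pos-* (norm (a + b i)) (norm (c + d i)) ⟨
    ℤ.+ (norm (a + b i) ℕ.* norm (c + d i)) ∎)
    where
    open ≡-Reasoning
    square : ∀ a → ℤ.+ (∣ a ∣ ℕ.* ∣ a ∣) ≡ a ℤ.* a
    square (ℤ.+ m)    = ℤP.pos-* m m
    square ℤ.-[1+ m ] = refl
    +norm : ∀ a b → ℤ.+ norm (a + b i) ≡ a ℤ.* a ℤ.+ b ℤ.* b
    +norm a b = trans (ℤP.pos-+ (∣ a ∣ ℕ.* ∣ a ∣) (∣ b ∣ ℕ.* ∣ b ∣)) (cong₂ ℤ._+_ (square a) (square b))

  unit-rePositive⇒1# : ∀ {w z} → w * z ≡ 1# → 0ℤ ℤ.< re z → z ≡ 1#
  unit-rePositive⇒1# {w} {(ℤ.+ suc a) + b i} wz≡1 (ℤ.+<+ _) =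
    cong₂ _+_i (cong (λ a → ℤ.+ suc a) a≡0) (ℤP.∣i∣≡0⇒i≡0 (Sum.reduce (ℕP.m*n≡0⇒m≡0∨n≡0 ∣ b ∣ b²≡0)))
    where
    norm≡1 : suc ((a ℕ.+ a ℕ.* suc a) ℕ.+ ∣ b ∣ ℕ.* ∣ b ∣) ≡ 1
    norm≡1 = ℕP.m*n≡1⇒n≡1 (norm w) _ (trans (sym (norm-* w _)) (cong norm wz≡1))
    a≡0 : a ≡ 0
    a≡0 = ℕP.m+n≡0⇒m≡0 a (ℕP.m+n≡0⇒m≡0 _ (ℕP.suc-injective norm≡1))
    b²≡0 : ∣ b ∣ ℕ.* ∣ b ∣ ≡ 0
    b²≡0 = ℕP.m+n≡0⇒n≡0 (a ℕ.+ a ℕ.* suc a) (ℕP.suc-injective norm≡1)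

  re-*-fromℕ : ∀ z l → re (z * fromℕ l) ≡ re z ℤ.* ℤ.+ l
  re-*-fromℕ (a + b i) l = Coordinates.*-real-re a b (ℤ.+ l)

  *-fromℕ-cancel : ∀ {z l} → 0 ℕ.< l → z * fromℕ l ≡ fromℕ l → z ≡ 1#
  *-fromℕ-cancel {a + b i} {suc l} _ zl≡l = cong₂ _+_i
    (ℤP.*-cancelʳ-≡ a 1ℤ (ℤ.+ suc l)
      (trans (sym (re-*-fromℕ (a + b i) (suc l))) (trans (cong re zl≡l) (sym (ℤP.*-identityˡ _)))))
    (ℤP.*-cancelʳ-≡ b 0ℤ (ℤ.+ suc l) (trans (sym (Coordinates.*-real-im a b (ℤ.+ suc l))) (cong im zl≡l)))

neg : (R : Ring) → Carrier R → Carrier R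
neg `ℤ    = ℤ.-_
neg `ℤ[i] = Gaussian.-_

isCommutativeRing : (R : Ring) → IsCommutativeRing _≡_ (add R) (mul R) (neg R) (zeroR R) (oneR R)
isCommutativeRing `ℤ    = ℤP.+-*-isCommutativeRing
isCommutativeRing `ℤ[i] = Gaussian.isCommutativeRing

commutativeRing : Ring → CommutativeRing 0ℓ 0ℓ
commutativeRing R = record { isCommutativeRing = isCommutativeRing R }

conj-+ : (R : Ring) → ∀ x y → conj R (add R x y) ≡ add R (conj R x) (conj R y)
conj-+ `ℤ    x y = refl
conj-+ `ℤ[i] (a + b i) (c + d i) = cong ((a ℤ.+ c) +_i) (ℤP.neg-distrib-+ b d)

conj-* : (R : Ring) → ∀ x y → conj R (mul R x y) ≡ mul R (conj R x) (conj R y)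
conj-* `ℤ    x y = refl
conj-* `ℤ[i] (a + b i) (c + d i) = cong₂ _+_i (Coordinates.conj-*-re a b c d) (Coordinates.conj-*-im a b c d)

conj-0# : (R : Ring) → conj R (zeroR R) ≡ zeroR R
conj-0# `ℤ    = refl
conj-0# `ℤ[i] = refl

conj-1# : (R : Ring) → conj R (oneR R) ≡ oneR R
conj-1# `ℤ    = refl
conj-1# `ℤ[i] = refl

ℤ-homomorphism : (R : Ring) →
  ℤ.+-*-rawRing Almost.-Raw-AlmostCommutative⟶ Almost.fromCommutativeRing (commutativeRing R)
ℤ-homomorphism `ℤ = record
  { ⟦_⟧ = λ x → x ; +-homo = λ _ _ → refl ; -‿homo = λ _ → refl ; 0-homo = refl ; 1-homo = refl
  ; *-homo = λ _ _ → refl }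
ℤ-homomorphism `ℤ[i] = record
  { ⟦_⟧ = λ x → x + 0ℤ i ; +-homo = λ _ _ → refl ; -‿homo = λ _ → refl ; 0-homo = refl ; 1-homo = refl
  ; *-homo = λ x y → cong₂ _+_i (Coordinates.real-*-re x y) (Coordinates.real-*-im x y) }

-- Coefficients live in ℤ because the constants of an abstract R do not compute, so the
-- solver could not cancel them.
module RingSolver (R : Ring) =
  Algebra.Solver.Ring ℤ.+-*-rawRing (Almost.fromCommutativeRing (commutativeRing R)) (ℤ-homomorphism R)
    (λ a b → Maybe.map (cong (Almost._-Raw-AlmostCommutative⟶_.⟦_⟧ (ℤ-homomorphism R))) (dec⇒maybe (a ℤ.≟ b)))

module Theory (R : Ring) where
  open CommutativeRing (commutativeRing R) hiding (Carrier; refl; sym; trans; reflexive; _≈_; zero)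
  open import Algebra.Definitions.RawMagma *-rawMagma public using (_∣_; _∥_; _,_)
  open import Algebra.Properties.CommutativeSemigroup *-commutativeSemigroup using (x∙yz≈y∙xz)
  open import Algebra.Properties.CommutativeSemigroup.Divisibility *-commutativeSemigroup
    using (∣ʳ-trans; ∣ʳ-respʳ-≈; ∙-cong-∣; x∣ʳy⇒xz∣ʳyz; x∣xy)
  open import Algebra.Properties.CommutativeSemiring.Exp commutativeSemiring using (_^_; ^-distrib-*; ^-homo-*)
  open import Algebra.Properties.Monoid.Divisibility *-monoid using (∣ʳ-refl)
  open import Algebra.Properties.Ring ring using (-‿involutive; -1*x≈-x; -‿distribˡ-*; -0#≈0#)
  open import Algebra.Properties.Semiring.Sum semiring
    using ( sum; sum-cong-≗; sum-remove; sum-replicate-zero; sum-permute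
          ; ∑-distrib-+; ∑-comm; *-distribˡ-sum; *-distribʳ-sum)
  open RingSolver R using (solve; _:=_; _:+_; _:-_; _:*_; :-_)

  private
    variable
      n : ℕ
      A B C A′ B′ : Mat R n

  -- Matrices over R

  sumFin≡sum : (f : Fin n → Carrier R) → sumFin R f ≡ sum f
  sumFin≡sum {zero}  f = refl
  sumFin≡sum {suc n} f = cong (f zero +_) (sumFin≡sum (f ∘ suc))

  sum-↑ : ∀ a b (f : Fin (a ℕ.+ b) → Carrier R) → sum f ≡ sum (f ∘ (_↑ˡ b)) + sum (f ∘ (a ↑ʳ_))
  sum-↑ zero    b f = sym (+-identityˡ (sum f))
  sum-↑ (suc a) b f = trans (cong (f zero +_) (sum-↑ a b (f ∘ suc))) (sym (+-assoc _ _ _))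

  sum-single : (f : Fin n → Carrier R) (j : Fin n) → (∀ k → k ≢ j → f k ≡ 0#) → sum f ≡ f j
  sum-single {suc n} f j f≡0 = begin
    sum f                      ≡⟨ sum-remove {i = j} f ⟩
    f j + sum (f ∘ punchIn j)  ≡⟨ cong (f j +_) (sum-cong-≗ (λ k → f≡0 (punchIn j k) (FinP.punchInᵢ≢i j k))) ⟩
    f j + sum {n} (λ _ → 0#)   ≡⟨ cong (f j +_) (sum-replicate-zero n) ⟩
    f j + 0#                   ≡⟨ +-identityʳ (f j) ⟩
    f j                        ∎
    where open ≡-Reasoning

  conj-sum : (f : Fin n → Carrier R) → conj R (sum f) ≡ sum (conj R ∘ f)
  conj-sum {zero}  f = conj-0# R
  conj-sum {suc n} f = trans (conj-+ R _ _) (cong (conj R (f zero) +_) (conj-sum (f ∘ suc)))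

  infixl 7 _⊗_
  _⊗_ : Mat R n → Mat R n → Mat R n
  _⊗_ = D._⊗_ R

  infix 8 _ᴴ
  _ᴴ : Mat R n → Mat R n
  _ᴴ = D._* R

  infix 4 _≐_
  _≐_ : Mat R n → Mat R n → Set
  _≐_ = D._≐_ R

  diag : (Fin n → Carrier R) → Mat R n
  diag = D.diag R

  I : Mat R n
  I = D.I R

  ≐-setoid : ℕ → Setoid _ _
  ≐-setoid n = record
    { Carrier = Mat R n
    ; _≈_ = _≐_
    ; isEquivalence = record
      { refl  = λ r s → refl
      ; sym   = λ A≐B r s → sym (A≐B r s)
      ; trans = λ A≐B B≐C r s → trans (A≐B r s) (B≐C r s) } }

  module ≐-Reasoning {n} = SetoidReasoning (≐-setoid n)

  ⊗-entry : (A B : Mat R n) → ∀ r s → (A ⊗ B) r s ≡ sum (λ k → A r k * B k s)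
  ⊗-entry {n} A B r s = sumFin≡sum {n} (λ k → A r k * B k s)

  ⊗-cong : A ≐ A′ → B ≐ B′ → A ⊗ B ≐ A′ ⊗ B′
  ⊗-cong {A = A} {A′ = A′} {B = B} {B′ = B′} A≐A′ B≐B′ r s = begin
    (A ⊗ B) r s                    ≡⟨ ⊗-entry A B r s ⟩
    sum (λ k → A r k * B k s)      ≡⟨ sum-cong-≗ (λ k → cong₂ _*_ (A≐A′ r k) (B≐B′ k s)) ⟩
    sum (λ k → A′ r k * B′ k s)    ≡⟨ ⊗-entry A′ B′ r s ⟨
    (A′ ⊗ B′) r s                  ∎
    where open ≡-Reasoning

  ⊗-congˡ : B ≐ B′ → A ⊗ B ≐ A ⊗ B′
  ⊗-congˡ = ⊗-cong (λ _ _ → refl)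

  ⊗-congʳ : A ≐ A′ → A ⊗ B ≐ A′ ⊗ B
  ⊗-congʳ A≐A′ = ⊗-cong A≐A′ (λ _ _ → refl)

  ⊗-assoc : (A B C : Mat R n) → (A ⊗ B) ⊗ C ≐ A ⊗ (B ⊗ C)
  ⊗-assoc A B C r s = begin
    ((A ⊗ B) ⊗ C) r s
      ≡⟨ ⊗-entry (A ⊗ B) C r s ⟩
    sum (λ k → (A ⊗ B) r k * C k s)
      ≡⟨ sum-cong-≗ (λ k → cong (_* C k s) (⊗-entry A B r k)) ⟩
    sum (λ k → sum (λ m → A r m * B m k) * C k s)
      ≡⟨ sum-cong-≗ (λ k → *-distribʳ-sum (C k s) (λ m → A r m * B m k)) ⟩
    sum (λ k → sum (λ m → A r m * B m k * C k s))
      ≡⟨ ∑-comm (λ k m → A r m * B m k * C k s) ⟩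
    sum (λ m → sum (λ k → A r m * B m k * C k s))
      ≡⟨ sum-cong-≗ (λ m → sum-cong-≗ (λ k → *-assoc (A r m) (B m k) (C k s))) ⟩
    sum (λ m → sum (λ k → A r m * (B m k * C k s)))
      ≡⟨ sum-cong-≗ (λ m → *-distribˡ-sum (A r m) (λ k → B m k * C k s)) ⟨
    sum (λ m → A r m * sum (λ k → B m k * C k s))
      ≡⟨ sum-cong-≗ (λ m → cong (A r m *_) (⊗-entry B C m s)) ⟨
    sum (λ m → A r m * (B ⊗ C) m s)
      ≡⟨ ⊗-entry A (B ⊗ C) r s ⟨
    (A ⊗ (B ⊗ C)) r s ∎
    where open ≡-Reasoning

  diag-≡ : (d : Fin n → Carrier R) → ∀ r → diag d r r ≡ d r
  diag-≡ d r with r Fin.≟ r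
  ... | yes _  = refl
  ... | no r≢r = contradiction refl r≢r

  diag-≢ : (d : Fin n → Carrier R) {r s : Fin n} → r ≢ s → diag d r s ≡ 0#
  diag-≢ d {r} {s} r≢s with r Fin.≟ s
  ... | yes r≡s = contradiction r≡s r≢s
  ... | no _    = refl

  diag-cong : {d d′ : Fin n → Carrier R} → (∀ k → d k ≡ d′ k) → diag d ≐ diag d′
  diag-cong d≗d′ r s with r Fin.≟ s
  ... | yes _ = d≗d′ r
  ... | no _  = refl

  diag-⊗ : (d : Fin n → Carrier R) (A : Mat R n) → ∀ r s → (diag d ⊗ A) r s ≡ d r * A r s
  diag-⊗ d A r s = begin
    (diag d ⊗ A) r s                ≡⟨ ⊗-entry (diag d) A r s ⟩
    sum (λ k → diag d r k * A k s)  ≡⟨ sum-single _ r (λ k k≢r → trans (cong (_* A k s) (diag-≢ d (k≢r ∘ sym)))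
                                                                        (zeroˡ _)) ⟩
    diag d r r * A r s              ≡⟨ cong (_* A r s) (diag-≡ d r) ⟩
    d r * A r s                     ∎
    where open ≡-Reasoning

  ⊗-diag : (A : Mat R n) (d : Fin n → Carrier R) → ∀ r s → (A ⊗ diag d) r s ≡ A r s * d s
  ⊗-diag A d r s = begin
    (A ⊗ diag d) r s                ≡⟨ ⊗-entry A (diag d) r s ⟩
    sum (λ k → A r k * diag d k s)  ≡⟨ sum-single _ s (λ k k≢s → trans (cong (A r k *_) (diag-≢ d k≢s)) (zeroʳ _)) ⟩
    A r s * diag d s s              ≡⟨ cong (A r s *_) (diag-≡ d s) ⟩
    A r s * d s                     ∎
    where open ≡-Reasoning

  ⊗-identityˡ : (A : Mat R n) → I ⊗ A ≐ A
  ⊗-identityˡ A r s = trans (diag-⊗ _ A r s) (*-identityˡ (A r s))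

  ⊗-identityʳ : (A : Mat R n) → A ⊗ I ≐ A
  ⊗-identityʳ A r s = trans (⊗-diag A _ r s) (*-identityʳ (A r s))

  ᴴ-cong : A ≐ B → A ᴴ ≐ B ᴴ
  ᴴ-cong A≐B r s = cong (conj R) (A≐B s r)

  ᴴ-⊗ : (A B : Mat R n) → (A ⊗ B) ᴴ ≐ B ᴴ ⊗ A ᴴ
  ᴴ-⊗ A B r s = begin
    conj R ((A ⊗ B) s r)                          ≡⟨ cong (conj R) (⊗-entry A B s r) ⟩
    conj R (sum (λ k → A s k * B k r))            ≡⟨ conj-sum (λ k → A s k * B k r) ⟩
    sum (λ k → conj R (A s k * B k r))            ≡⟨ sum-cong-≗ (λ k → trans (conj-* R (A s k) (B k r))
                                                                              (*-comm (conj R (A s k)) (conj R (B k r)))) ⟩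
    sum (λ k → conj R (B k r) * conj R (A s k))   ≡⟨ ⊗-entry (B ᴴ) (A ᴴ) r s ⟨
    (B ᴴ ⊗ A ᴴ) r s                               ∎
    where open ≡-Reasoning

  diag-ᴴ : (d : Fin n → Carrier R) → diag d ᴴ ≐ diag (conj R ∘ d)
  diag-ᴴ d r s with r Fin.≟ s | s Fin.≟ r
  ... | yes refl | yes _   = refl
  ... | yes refl | no s≢s  = contradiction refl s≢s
  ... | no r≢s   | yes s≡r = contradiction (sym s≡r) r≢s
  ... | no _     | no _    = conj-0# R

  I-ᴴ : I ᴴ ≐ I {n}
  I-ᴴ r s = trans (diag-ᴴ _ r s) (diag-cong (λ _ → conj-1# R) r s)

  reverse : Mat R n → Mat R n
  reverse A r s = A (opposite r) (opposite s)

  reverse-I : reverse I ≐ I {n}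
  reverse-I r s = by-cases (r Fin.≟ s)
    where
    by-cases : Dec (r ≡ s) → reverse I r s ≡ I r s
    by-cases (yes refl) = trans (diag-≡ _ (opposite r)) (sym (diag-≡ _ r))
    by-cases (no r≢s)   = trans (diag-≢ _ (r≢s ∘ opposite-injective)) (sym (diag-≢ _ r≢s))

  reverse-inverse : A ⊗ B ≐ I → reverse A ⊗ reverse B ≐ I
  reverse-inverse {A = A} {B} AB≐I r s = begin
    (reverse A ⊗ reverse B) r s
      ≡⟨ ⊗-entry (reverse A) (reverse B) r s ⟩
    sum (λ k → A (opposite r) (opposite k) * B (opposite k) (opposite s))
      ≡⟨ sum-permute (λ k → A (opposite r) k * B k (opposite s)) Perm.reverse ⟨
    sum (λ k → A (opposite r) k * B k (opposite s))
      ≡⟨ ⊗-entry A B (opposite r) (opposite s) ⟨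
    (A ⊗ B) (opposite r) (opposite s)
      ≡⟨ AB≐I (opposite r) (opposite s) ⟩
    reverse I r s
      ≡⟨ reverse-I r s ⟩
    I r s ∎
    where open ≡-Reasoning

  Gram : Mat R n → Mat R n
  Gram P = P ᴴ ⊗ P

  congruence : Mat R n → Mat R n → Mat R n
  congruence Y X = Y ᴴ ⊗ X ⊗ Y

  Gram-cong : A ≐ B → Gram A ≐ Gram B
  Gram-cong A≐B = ⊗-cong (ᴴ-cong A≐B) A≐B

  congruence-cong : A ≐ B → congruence C A ≐ congruence C B
  congruence-cong A≐B = ⊗-congʳ (⊗-congˡ A≐B)

  congruence-congˡ : A ≐ B → congruence A C ≐ congruence B C
  congruence-congˡ A≐B = ⊗-cong (⊗-congʳ (ᴴ-cong A≐B)) A≐B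

  Gram-⊗ : (X Y : Mat R n) → Gram (X ⊗ Y) ≐ congruence Y (Gram X)
  Gram-⊗ X Y = begin
    (X ⊗ Y) ᴴ ⊗ (X ⊗ Y)    ≈⟨ ⊗-congʳ (ᴴ-⊗ X Y) ⟩
    Y ᴴ ⊗ X ᴴ ⊗ (X ⊗ Y)    ≈⟨ ⊗-assoc (Y ᴴ ⊗ X ᴴ) X Y ⟨
    Y ᴴ ⊗ X ᴴ ⊗ X ⊗ Y      ≈⟨ ⊗-congʳ (⊗-assoc (Y ᴴ) (X ᴴ) X) ⟩
    Y ᴴ ⊗ (X ᴴ ⊗ X) ⊗ Y    ∎
    where open ≐-Reasoning

  congruence-⊗ : (Y Y′ X : Mat R n) → congruence (Y ⊗ Y′) X ≐ congruence Y′ (congruence Y X)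
  congruence-⊗ Y Y′ X = begin
    (Y ⊗ Y′) ᴴ ⊗ X ⊗ (Y ⊗ Y′)    ≈⟨ ⊗-congʳ (⊗-congʳ (ᴴ-⊗ Y Y′)) ⟩
    Y′ ᴴ ⊗ Y ᴴ ⊗ X ⊗ (Y ⊗ Y′)    ≈⟨ ⊗-assoc (Y′ ᴴ ⊗ Y ᴴ ⊗ X) Y Y′ ⟨
    Y′ ᴴ ⊗ Y ᴴ ⊗ X ⊗ Y ⊗ Y′      ≈⟨ ⊗-congʳ (⊗-congʳ (⊗-assoc (Y′ ᴴ) (Y ᴴ) X)) ⟩
    Y′ ᴴ ⊗ (Y ᴴ ⊗ X) ⊗ Y ⊗ Y′    ≈⟨ ⊗-congʳ (⊗-assoc (Y′ ᴴ) (Y ᴴ ⊗ X) Y) ⟩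
    Y′ ᴴ ⊗ (Y ᴴ ⊗ X ⊗ Y) ⊗ Y′    ∎
    where open ≐-Reasoning

  congruence-I : (X : Mat R n) → congruence I X ≐ X
  congruence-I X = begin
    I ᴴ ⊗ X ⊗ I    ≈⟨ ⊗-identityʳ (I ᴴ ⊗ X) ⟩
    I ᴴ ⊗ X        ≈⟨ ⊗-congʳ I-ᴴ ⟩
    I ⊗ X          ≈⟨ ⊗-identityˡ X ⟩
    X              ∎
    where open ≐-Reasoning

  congruence-inverse : {Y Y′ : Mat R n} (X : Mat R n) → Y ⊗ Y′ ≐ I → congruence Y′ (congruence Y X) ≐ X
  congruence-inverse {Y = Y} {Y′} X YY′≐I = begin
    congruence Y′ (congruence Y X)   ≈⟨ congruence-⊗ Y Y′ X ⟨
    congruence (Y ⊗ Y′) X            ≈⟨ congruence-congˡ YY′≐I ⟩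
    congruence I X                   ≈⟨ congruence-I X ⟩
    X                                ∎
    where open ≐-Reasoning

  congruence-diag : (d : Fin n → Carrier R) (X : Mat R n) →
    ∀ r s → congruence (diag d) X r s ≡ conj R (d r) * X r s * d s
  congruence-diag d X r s = begin
    (diag d ᴴ ⊗ X ⊗ diag d) r s          ≡⟨ ⊗-diag (diag d ᴴ ⊗ X) d r s ⟩
    (diag d ᴴ ⊗ X) r s * d s             ≡⟨ cong (_* d s) (⊗-congʳ {B = X} (diag-ᴴ d) r s) ⟩
    (diag (conj R ∘ d) ⊗ X) r s * d s    ≡⟨ cong (_* d s) (diag-⊗ (conj R ∘ d) X r s) ⟩
    conj R (d r) * X r s * d s           ∎
    where open ≡-Reasoning

  congruence-scalar : (c : Carrier R) (Y : Mat R n) → ∀ r s → congruence Y (diag (λ _ → c)) r s ≡ c * Gram Y r s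
  congruence-scalar c Y r s = begin
    (Y ᴴ ⊗ diag (λ _ → c) ⊗ Y) r s
      ≡⟨ ⊗-entry (Y ᴴ ⊗ diag (λ _ → c)) Y r s ⟩
    sum (λ k → (Y ᴴ ⊗ diag (λ _ → c)) r k * Y k s)
      ≡⟨ sum-cong-≗ (λ k → cong (_* Y k s) (⊗-diag (Y ᴴ) (λ _ → c) r k)) ⟩
    sum (λ k → (Y ᴴ) r k * c * Y k s)
      ≡⟨ sum-cong-≗ (λ k → x*c*y≡c*[x*y] ((Y ᴴ) r k) c (Y k s)) ⟩
    sum (λ k → c * ((Y ᴴ) r k * Y k s))
      ≡⟨ *-distribˡ-sum c (λ k → (Y ᴴ) r k * Y k s) ⟨
    c * sum (λ k → (Y ᴴ) r k * Y k s)
      ≡⟨ cong (c *_) (⊗-entry (Y ᴴ) Y r s) ⟨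
    c * Gram Y r s ∎
    where
    open ≡-Reasoning
    x*c*y≡c*[x*y] : ∀ x c y → x * c * y ≡ c * (x * y)
    x*c*y≡c*[x*y] = solve 3 (λ x c y → x :* c :* y := c :* (x :* y)) refl

  Gram-inverse : {P P′ : Mat R n} → P ⊗ P′ ≐ I → P′ ⊗ P ≐ I → Gram P ⊗ (P′ ⊗ P′ ᴴ) ≐ I
  Gram-inverse {P = P} {P′} PP′≐I P′P≐I = begin
    P ᴴ ⊗ P ⊗ (P′ ⊗ P′ ᴴ)      ≈⟨ ⊗-assoc (P ᴴ) P (P′ ⊗ P′ ᴴ) ⟩
    P ᴴ ⊗ (P ⊗ (P′ ⊗ P′ ᴴ))    ≈⟨ ⊗-congˡ (⊗-assoc P P′ (P′ ᴴ)) ⟨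
    P ᴴ ⊗ (P ⊗ P′ ⊗ P′ ᴴ)      ≈⟨ ⊗-congˡ (⊗-congʳ PP′≐I) ⟩
    P ᴴ ⊗ (I ⊗ P′ ᴴ)           ≈⟨ ⊗-congˡ (⊗-identityˡ (P′ ᴴ)) ⟩
    P ᴴ ⊗ P′ ᴴ                 ≈⟨ ᴴ-⊗ P′ P ⟨
    (P′ ⊗ P) ᴴ                 ≈⟨ ᴴ-cong P′P≐I ⟩
    I ᴴ                        ≈⟨ I-ᴴ ⟩
    I                          ∎
    where open ≐-Reasoning

  Smith-Gram-identity : {A P Q Q′ : Mat R n} (α : Fin n → Carrier R) (c : Carrier R) →
    A ≐ P ⊗ diag α ⊗ Q → Q ⊗ Q′ ≐ I → Gram A ≐ diag (λ _ → c) →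
    ∀ r s → conj R (α r) * Gram P r s * α s ≡ c * Gram Q′ r s
  Smith-Gram-identity {A = A} {P} {Q} {Q′} α c A≐PDQ QQ′≐I GramA≐c r s =
    trans (sym (congruence-diag α (Gram P) r s)) (trans (matrix-form r s) (congruence-scalar c Q′ r s))
    where
    D = diag α
    matrix-form : congruence D (Gram P) ≐ congruence Q′ (diag (λ _ → c))
    matrix-form = begin
      congruence D (Gram P)                                  ≈⟨ congruence-inverse _ QQ′≐I ⟨
      congruence Q′ (congruence Q (congruence D (Gram P)))   ≈⟨ congruence-cong (congruence-cong (Gram-⊗ P D)) ⟨
      congruence Q′ (congruence Q (Gram (P ⊗ D)))            ≈⟨ congruence-cong (Gram-⊗ (P ⊗ D) Q) ⟨
      congruence Q′ (Gram (P ⊗ D ⊗ Q))                       ≈⟨ congruence-cong (Gram-cong A≐PDQ) ⟨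
      congruence Q′ (Gram A)                                 ≈⟨ congruence-cong GramA≐c ⟩
      congruence Q′ (diag (λ _ → c))                         ∎
      where open ≐-Reasoning

  -- Ideals and the rank argument

  record IsIdeal (J : Carrier R → Set) : Set where
    field
      0#∈      : J 0#
      +-closed : ∀ {x y} → J x → J y → J (x + y)
      *-closed : ∀ a {x} → J x → J (a * x)

    *ʳ-closed : ∀ a {x} → J x → J (x * a)
    *ʳ-closed a {x} x∈J = subst J (*-comm a x) (*-closed a x∈J)

    -‿closed : ∀ {x} → J x → J (- x)
    -‿closed {x} x∈J = subst J (-1*x≈-x x) (*-closed (- 1#) x∈J)

    difference-closed : ∀ {x y} → J x → J y → J (x - y)
    difference-closed x∈J y∈J = +-closed x∈J (-‿closed y∈J)

    sum-closed : (f : Fin n → Carrier R) → (∀ k → J (f k)) → J (sum f)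
    sum-closed {zero}  f f∈J = 0#∈
    sum-closed {suc n} f f∈J = +-closed (f∈J zero) (sum-closed (f ∘ suc) (f∈J ∘ suc))

  colon-isIdeal : (a b : Carrier R) → IsIdeal (λ x → b ∣ a * x)
  colon-isIdeal a b = record
    { 0#∈ = 0# , trans (zeroˡ b) (sym (zeroʳ a))
    ; +-closed = λ { {x} {y} (p , pb≡ax) (q , qb≡ay) →
        p + q , trans (distribʳ b p q) (trans (cong₂ _+_ pb≡ax qb≡ay) (sym (distribˡ a x y))) }
    ; *-closed = λ { z {x} (p , pb≡ax) →
        z * p , trans (*-assoc z p b) (trans (cong (z *_) pb≡ax) (x∙yz≈y∙xz z a x)) }
    }

  Radical : (Carrier R → Set) → Carrier R → Set
  Radical J x = ∃ λ m → J (x ^ m)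

  binomial-split : ∀ x y p q → ∃₂ λ U V → (x + y) ^ (p ℕ.+ q) ≡ U * x ^ p + V * y ^ q
  binomial-split x y zero q = (x + y) ^ q , 0# , sym (begin
    (x + y) ^ q * 1# + 0# * y ^ q   ≡⟨ cong₂ _+_ (*-identityʳ _) (zeroˡ _) ⟩
    (x + y) ^ q + 0#                ≡⟨ +-identityʳ _ ⟩
    (x + y) ^ q                     ∎)
    where open ≡-Reasoning
  binomial-split x y (suc p) zero = 0# , (x + y) ^ suc (p ℕ.+ 0) , sym (begin
    0# * x ^ suc p + (x + y) ^ suc (p ℕ.+ 0) * 1#   ≡⟨ cong₂ _+_ (zeroˡ _) (*-identityʳ _) ⟩
    0# + (x + y) ^ suc (p ℕ.+ 0)                    ≡⟨ +-identityˡ _ ⟩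
    (x + y) ^ suc (p ℕ.+ 0)                         ∎)
    where open ≡-Reasoning
  binomial-split x y (suc p) (suc q)
    with binomial-split x y p (suc q) | binomial-split x y (suc p) q
  ... | U₁ , V₁ , eq₁ | U₂ , V₂ , eq₂ = U₁ + y * U₂ , x * V₁ + V₂ , (begin
    (x + y) * (x + y) ^ (p ℕ.+ suc q)
      ≡⟨ distribʳ _ x y ⟩
    x * (x + y) ^ (p ℕ.+ suc q) + y * (x + y) ^ (p ℕ.+ suc q)
      ≡⟨ cong₂ (λ u v → x * u + y * v) eq₁ (trans (cong ((x + y) ^_) (ℕP.+-suc p q)) eq₂) ⟩
    x * (U₁ * x ^ p + V₁ * (y * y ^ q)) + y * (U₂ * (x * x ^ p) + V₂ * y ^ q)
      ≡⟨ regroup x y U₁ V₁ U₂ V₂ (x ^ p) (y ^ q) ⟩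
    (U₁ + y * U₂) * (x * x ^ p) + (x * V₁ + V₂) * (y * y ^ q) ∎)
    where
    open ≡-Reasoning
    regroup : ∀ x y U₁ V₁ U₂ V₂ X Y →
      x * (U₁ * X + V₁ * (y * Y)) + y * (U₂ * (x * X) + V₂ * Y) ≡
      (U₁ + y * U₂) * (x * X) + (x * V₁ + V₂) * (y * Y)
    regroup = solve 8 (λ x y U₁ V₁ U₂ V₂ X Y →
      x :* (U₁ :* X :+ V₁ :* (y :* Y)) :+ y :* (U₂ :* (x :* X) :+ V₂ :* Y)
        := (U₁ :+ y :* U₂) :* (x :* X) :+ (x :* V₁ :+ V₂) :* (y :* Y)) refl

  module _ {J : Carrier R → Set} (J-ideal : IsIdeal J) where
    open IsIdeal J-ideal

    ⊆-radical : ∀ {x} → J x → Radical J x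
    ⊆-radical {x} x∈J = 1 , subst J (sym (*-identityʳ x)) x∈J

    radical-isIdeal : IsIdeal (Radical J)
    radical-isIdeal = record
      { 0#∈ = ⊆-radical 0#∈
      ; +-closed = λ { {x} {y} (p , xᵖ∈J) (q , yᵠ∈J) →
          let U , V , eq = binomial-split x y p q
          in p ℕ.+ q , subst J (sym eq) (+-closed (*-closed U xᵖ∈J) (*-closed V yᵠ∈J)) }
      ; *-closed = λ { a {x} (m , xᵐ∈J) → m , subst J (sym (^-distrib-* a x m)) (*-closed (a ^ m) xᵐ∈J) }
      }

    radical-square : ∀ {x} → Radical J (x * x) → Radical J x
    radical-square {x} (m , [xx]ᵐ∈J) = m ℕ.+ m , subst J (trans (^-distrib-* x x m) (sym (^-homo-* x m m))) [xx]ᵐ∈J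

    1#∈radical⇒1#∈ : Radical J 1# → J 1#
    1#∈radical⇒1#∈ (m , 1ᵐ∈J) = subst J (1#^m≡1# m) 1ᵐ∈J
      where
      1#^m≡1# : ∀ m → 1# ^ m ≡ 1#
      1#^m≡1# zero    = refl
      1#^m≡1# (suc m) = trans (*-identityˡ _) (1#^m≡1# m)

  infixl 7 _·_
  _·_ : ∀ {a m b} → (Fin a → Fin m → Carrier R) → (Fin m → Fin b → Carrier R) → Fin a → Fin b → Carrier R
  (X · Y) r s = sum (λ c → X r c * Y c s)

  record ScalarModulo (J : Carrier R → Set) (t : Carrier R) {a} (Z : Fin a → Fin a → Carrier R) : Set where
    field
      diagonal     : ∀ r → J (Z r r - t)
      off-diagonal : ∀ {r s} → r ≢ s → J (Z r s)

  eliminate : ∀ {a m} → (Fin (suc a) → Fin (suc m) → Carrier R) → Fin (suc m) → Fin a → Fin m → Carrier R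
  eliminate X c r c′ = X zero c * X (suc r) (punchIn c c′) - X (suc r) c * X zero (punchIn c c′)

  eliminate-· : ∀ {a m b} (X : Fin (suc a) → Fin (suc m) → Carrier R) (Y : Fin (suc m) → Fin (suc b) → Carrier R) →
    ∀ c r s →
    (eliminate X c · (λ c′ s′ → Y (punchIn c c′) (suc s′))) r s ≡
    X zero c * (X · Y) (suc r) (suc s) - X (suc r) c * (X · Y) zero (suc s)
  eliminate-· X Y c r s = begin
    sum (g ∘ punchIn c)
      ≡⟨ cancel-pivot e a (Y c (suc s)) (sum (g ∘ punchIn c)) ⟨
    g c + sum (g ∘ punchIn c)
      ≡⟨ sum-remove {i = c} g ⟨
    sum g
      ≡⟨ sum-cong-≗ (λ col → expand e a (X (suc r) col) (X zero col) (Y col (suc s))) ⟩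
    sum (λ col → e * (X (suc r) col * Y col (suc s)) + - a * (X zero col * Y col (suc s)))
      ≡⟨ ∑-distrib-+ (λ col → e * (X (suc r) col * Y col (suc s))) (λ col → - a * (X zero col * Y col (suc s))) ⟩
    sum (λ col → e * (X (suc r) col * Y col (suc s))) + sum (λ col → - a * (X zero col * Y col (suc s)))
      ≡⟨ cong₂ _+_ (*-distribˡ-sum e (λ col → X (suc r) col * Y col (suc s)))
                   (*-distribˡ-sum (- a) (λ col → X zero col * Y col (suc s))) ⟨
    e * (X · Y) (suc r) (suc s) + - a * (X · Y) zero (suc s)
      ≡⟨ cong (e * (X · Y) (suc r) (suc s) +_) (sym (-‿distribˡ-* a ((X · Y) zero (suc s)))) ⟩
    e * (X · Y) (suc r) (suc s) - a * (X · Y) zero (suc s) ∎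
    where
    open ≡-Reasoning
    e = X zero c
    a = X (suc r) c
    g : Fin _ → Carrier R
    g col = (e * X (suc r) col - a * X zero col) * Y col (suc s)
    cancel-pivot : ∀ e a y z → (e * a - a * e) * y + z ≡ z
    cancel-pivot = solve 4 (λ e a y z → (e :* a :- a :* e) :* y :+ z := z) refl
    expand : ∀ e a x₁ x₀ y → (e * x₁ - a * x₀) * y ≡ e * (x₁ * y) + - a * (x₀ * y)
    expand = solve 5 (λ e a x₁ x₀ y → (e :* x₁ :- a :* x₀) :* y := e :* (x₁ :* y) :+ :- a :* (x₀ :* y)) refl

  module _ {J : Carrier R → Set} (J-ideal : IsIdeal J) where
    open IsIdeal J-ideal
    private
      module √J = IsIdeal (radical-isIdeal J-ideal)

    -- Clearing column c from the other rows with pivot X₀c factors (X₀c t)·I through one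
    -- dimension less, so by induction every X₀c t is nilpotent modulo J, and hence so is
    -- t² = Σ_c Y_c0 (X₀c t) - t ((XY)₀₀ - t).
    scalar-factorization⇒radical : ∀ {m} (X : Fin (suc m) → Fin m → Carrier R) (Y : Fin m → Fin (suc m) → Carrier R) →
      ∀ t → ScalarModulo J t (X · Y) → Radical J t
    scalar-factorization⇒radical {zero} X Y t XY≡tI =
      ⊆-radical J-ideal (subst J (trans (cong -_ (+-identityˡ (- t))) (-‿involutive t)) (-‿closed (diagonal zero)))
      where open ScalarModulo XY≡tI
    scalar-factorization⇒radical {suc m} X Y t XY≡tI = radical-square J-ideal (subst (Radical J) (sym t*t≡) t*t∈√J)
      where
      open ScalarModulo XY≡tI
      S = (X · Y) zero zero
      t*t≡ : t * t ≡ sum (λ c → Y c zero * (X zero c * t)) - t * (S - t)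
      t*t≡ = trans (square t S) (cong (_- t * (S - t)) (trans (*-distribˡ-sum t (λ c → X zero c * Y c zero))
                                                             (sum-cong-≗ (λ c → rotate t (X zero c) (Y c zero)))))
        where
        square : ∀ t S → t * t ≡ t * S - t * (S - t)
        square = solve 2 (λ t S → t :* t := t :* S :- t :* (S :- t)) refl
        rotate : ∀ t x y → t * (x * y) ≡ y * (x * t)
        rotate = solve 3 (λ t x y → t :* (x :* y) := y :* (x :* t)) refl
      eliminated : ∀ c → ScalarModulo J (X zero c * t) (eliminate X c · (λ c′ s′ → Y (punchIn c c′) (suc s′)))
      eliminated c = record
        { diagonal = λ r → subst J (sym (trans (cong (_- e * t) (eliminate-· X Y c r r)) (shift e (X (suc r) c) _ _ t)))
            (difference-closed (*-closed e (diagonal (suc r))) (*-closed (X (suc r) c) (off-diagonal (λ ()))))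
        ; off-diagonal = λ r≢s → subst J (sym (eliminate-· X Y c _ _))
            (difference-closed (*-closed e (off-diagonal (r≢s ∘ FinP.suc-injective))) (*-closed _ (off-diagonal (λ ()))))
        }
        where
        e = X zero c
        shift : ∀ e a S₁ S₀ t → e * S₁ - a * S₀ - e * t ≡ e * (S₁ - t) - a * S₀
        shift = solve 5 (λ e a S₁ S₀ t → e :* S₁ :- a :* S₀ :- e :* t := e :* (S₁ :- t) :- a :* S₀) refl
      t*t∈√J : Radical J (sum (λ c → Y c zero * (X zero c * t)) - t * (S - t))
      t*t∈√J = √J.difference-closed
        (√J.sum-closed _ (λ c → √J.*-closed (Y c zero)
          (scalar-factorization⇒radical (eliminate X c) _ _ (eliminated c))))
        (⊆-radical J-ideal (*-closed t (diagonal zero)))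

    invertible-block⇒1#∈ : ∀ b m (M M′ : Mat R (b ℕ.+ m)) → M ⊗ M′ ≐ I →
      (ρ : Fin (suc m) → Fin (b ℕ.+ m)) → (∀ {r s} → ρ r ≡ ρ s → r ≡ s) →
      (∀ r c → J (M (ρ r) (c ↑ˡ m))) → J 1#
    invertible-block⇒1#∈ b m M M′ MM′≐I ρ ρ-injective M∈J =
      1#∈radical⇒1#∈ J-ideal (scalar-factorization⇒radical X Y 1# XY≡I)
      where
      X : Fin (suc m) → Fin m → Carrier R
      X r c = M (ρ r) (b ↑ʳ c)
      Y : Fin m → Fin (suc m) → Carrier R
      Y c s = M′ (b ↑ʳ c) (ρ s)
      block : ∀ r s → Carrier R
      block r s = sum (λ c → M (ρ r) (c ↑ˡ m) * M′ (c ↑ˡ m) (ρ s))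
      XY≡MM′ : ∀ r s → J ((X · Y) r s - (M ⊗ M′) (ρ r) (ρ s))
      XY≡MM′ r s = subst J (sym (begin
        (X · Y) r s - (M ⊗ M′) (ρ r) (ρ s)
          ≡⟨ cong (_-_ ((X · Y) r s)) (⊗-entry M M′ (ρ r) (ρ s)) ⟩
        (X · Y) r s - sum (λ c → M (ρ r) c * M′ c (ρ s))
          ≡⟨ cong (_-_ ((X · Y) r s)) (sum-↑ b m (λ c → M (ρ r) c * M′ c (ρ s))) ⟩
        (X · Y) r s - (block r s + (X · Y) r s)
          ≡⟨ y-[x+y]≡-x (block r s) ((X · Y) r s) ⟩
        - block r s ∎))
        (-‿closed (sum-closed _ (λ c → *ʳ-closed _ (M∈J r c))))
        where
        open ≡-Reasoning
        y-[x+y]≡-x : ∀ x y → y - (x + y) ≡ - x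
        y-[x+y]≡-x = solve 2 (λ x y → y :- (x :+ y) := :- x) refl
      XY≡I : ScalarModulo J 1# (X · Y)
      XY≡I = record
        { diagonal = λ r → subst J
            (cong (_-_ ((X · Y) r r)) (trans (MM′≐I (ρ r) (ρ r)) (diag-≡ _ (ρ r))))
            (XY≡MM′ r r)
        ; off-diagonal = λ {r} {s} r≢s → subst J
            (trans (cong (_-_ ((X · Y) r s)) (trans (MM′≐I (ρ r) (ρ s)) (diag-≢ _ (r≢s ∘ ρ-injective))))
                   (trans (cong ((X · Y) r s +_) -0#≈0#) (+-identityʳ _)))
            (XY≡MM′ r s)
        }

    top-left-block⇒1#∈ : ∀ u v (M M′ : Mat R n) → suc u ℕ.+ v ≡ n → M ⊗ M′ ≐ I →
      (∀ r c → toℕ r ℕ.≤ v → toℕ c ℕ.≤ u → J (M r c)) → J 1#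
    top-left-block⇒1#∈ u v M M′ refl MM′≐I M∈J =
      invertible-block⇒1#∈ (suc u) v M M′ MM′≐I ρ (FinP.inject≤-injective v<n v<n _ _)
        (λ r c → M∈J (ρ r) (c ↑ˡ v) (toℕ-ρ≤ r) (subst (ℕ._≤ u) (sym (FinP.toℕ-↑ˡ c v)) (FinP.toℕ≤pred[n] c)))
      where
      v<n : suc v ℕ.≤ suc u ℕ.+ v
      v<n = ℕ.s≤s (ℕP.m≤n+m v u)
      ρ : Fin (suc v) → Fin (suc u ℕ.+ v)
      ρ r = Fin.inject≤ r v<n
      toℕ-ρ≤ : ∀ r → toℕ (ρ r) ℕ.≤ v
      toℕ-ρ≤ r = subst (ℕ._≤ v) (sym (FinP.toℕ-inject≤ r v<n)) (FinP.toℕ≤pred[n] r)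

  -- Divisibility and the corner blocks

  ∣R⇒∣ : ∀ {x y} → _∣R_ R x y → x ∣ y
  ∣R⇒∣ (q , y≡qx) = q , sym y≡qx

  conj-∣ : ∀ {x y} → x ∣ y → conj R x ∣ conj R y
  conj-∣ {x} (q , qx≡y) = conj R q , trans (sym (conj-* R q x)) (cong (conj R) qx≡y)

  divisor-chain : (α : Fin n → Carrier R) → (∀ r s → toℕ s ≡ suc (toℕ r) → α r ∣ α s) →
    ∀ r s → toℕ r ℕ.≤ toℕ s → α r ∣ α s
  divisor-chain {n} α step r s r≤s = go (toℕ s ℕ.∸ toℕ r) s (sym (ℕP.m∸n+n≡m r≤s))
    where
    go : ∀ d s → toℕ s ≡ d ℕ.+ toℕ r → α r ∣ α s
    go zero    s s≡r = subst (λ s → α r ∣ α s) (FinP.toℕ-injective (sym s≡r)) ∣ʳ-refl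
    go (suc d) s s≡1+d+r = ∣ʳ-trans (go d s′ (FinP.toℕ-fromℕ< s′<n))
                                    (step s′ s (trans s≡1+d+r (cong suc (sym (FinP.toℕ-fromℕ< s′<n)))))
      where
      s′<n : d ℕ.+ toℕ r ℕ.< n
      s′<n = ℕP.<-trans (ℕP.n<1+n _) (subst (ℕ._< n) s≡1+d+r (FinP.toℕ<n s))
      s′ = Fin.fromℕ< s′<n

  corner-products-associated : (α : Fin n → Carrier R) → (∀ r s → toℕ r ℕ.≤ toℕ s → α r ∣ α s) →
    {M M′ N N′ : Mat R n} (c : Carrier R) → (∀ r s → conj R (α r) * M r s * α s ≡ c * N r s) →
    M ⊗ M′ ≐ I → N ⊗ N′ ≐ I → ∀ j → conj R (α j) * α (opposite j) ∥ c
  corner-products-associated α chain {M} {M′} {N} {N′} c D*MD≡cN MM′≐I NN′≐I j =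
    ∣ʳ-respʳ-≈ (*-identityʳ c) γ∣c*1 , ∣ʳ-respʳ-≈ (*-identityʳ γ) c∣γ*1
    where
    k = opposite j
    γ = conj R (α j) * α k
    cN≡ : ∀ r s → conj R (α r) * α s * M r s ≡ c * N r s
    cN≡ r s = trans (swap (conj R (α r)) (α s) (M r s)) (D*MD≡cN r s)
      where
      swap : ∀ x y m → x * y * m ≡ x * m * y
      swap = solve 3 (λ x y m → x :* y :* m := x :* m :* y) refl
    c∣γ*1 : c ∣ γ * 1#
    c∣γ*1 = top-left-block⇒1#∈ (colon-isIdeal γ c) (toℕ k) (toℕ j) M M′
      (trans (sym (ℕP.+-suc (toℕ k) (toℕ j))) (toℕ-opposite-+ j)) MM′≐I
      λ r s r≤j s≤k → ∣ʳ-trans (x∣xy c (N r s))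
        (subst (_∣ γ * M r s) (cN≡ r s)
          (x∣ʳy⇒xz∣ʳyz (M r s) (∙-cong-∣ (conj-∣ (chain r j r≤j)) (chain s k s≤k))))
    γ∣c*1 : γ ∣ c * 1#
    γ∣c*1 = top-left-block⇒1#∈ (colon-isIdeal c γ) (toℕ j) (toℕ k) (reverse N) (reverse N′)
      (trans (ℕP.+-comm (suc (toℕ j)) (toℕ k)) (toℕ-opposite-+ j)) (reverse-inverse NN′≐I)
      λ r s r≤k s≤j → subst (γ ∣_) (cN≡ (opposite r) (opposite s))
        (∣ʳ-trans (∙-cong-∣ (conj-∣ (chain j (opposite r) (opposite-≤-swap r≤k)))
                            (chain k (opposite s) (opposite-antitone s≤j)))
                  (x∣xy _ (M (opposite r) (opposite s))))

-- Divisibility in the standard library is a record whose constructor is also written _,_.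
open Theory using (_,_)

RePositive : (R : Ring) → Carrier R → Set
RePositive `ℤ    x = 0ℤ ℤ.< x
RePositive `ℤ[i] x = 0ℤ ℤ.< re x

conj-*-rePositive : (R : Ring) {x y : Carrier R} →
  Normalized R x → Normalized R y → RePositive R (mul R (conj R x) y)
conj-*-rePositive `ℤ {ℤ.+ suc a} {ℤ.+ suc c} (ℤ.+<+ _) (ℤ.+<+ _) = ℤ.+<+ (ℕ.s≤s ℕ.z≤n)
conj-*-rePositive `ℤ[i] {x@((ℤ.+ suc a) + (ℤ.+ b) i)} {y@((ℤ.+ suc c) + (ℤ.+ d) i)} (ℤ.+<+ _ , ℤ.+≤+ _) (ℤ.+<+ _ , ℤ.+≤+ _) =
  subst (0ℤ ℤ.<_) (sym re≡) (ℤ.+<+ (ℕ.s≤s ℕ.z≤n))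
  where
  re≡ : re (G.conj x G.* y) ≡ ℤ.+ (suc a ℕ.* suc c ℕ.+ b ℕ.* d)
  re≡ = trans (Coordinates.re-conj-* (ℤ.+ suc a) (ℤ.+ b) (ℤ.+ suc c) (ℤ.+ d))
              (trans (cong₂ ℤ._+_ (sym (ℤP.pos-* (suc a) (suc c))) (sym (ℤP.pos-* b d)))
                     (sym (ℤP.pos-+ _ (b ℕ.* d))))

associated-rePositive⇒≡ : (R : Ring) {x : Carrier R} {l : ℕ} →
  0 ℕ.< l → RePositive R x → Theory._∥_ R x (ι R l) → x ≡ ι R l
associated-rePositive⇒≡ `ℤ {ℤ.+ suc m} {l} _ (ℤ.+<+ _) ((q₁ , q₁x≡l) , (q₂ , q₂l≡x)) =
  cong ℤ.+_ (ℕ∣.∣-antisym (ℕ∣.divides ∣ q₁ ∣ (trans (cong ∣_∣ (sym q₁x≡l)) (ℤP.abs-* q₁ _)))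
                          (ℕ∣.divides ∣ q₂ ∣ (trans (cong ∣_∣ (sym q₂l≡x)) (ℤP.abs-* q₂ _))))
associated-rePositive⇒≡ `ℤ[i] {x} {l} 0<l 0<re-x ((q₁ , q₁x≡l) , (q₂ , q₂l≡x)) =
  trans (sym q₂l≡x) (trans (cong (G._* G.fromℕ l) q₂≡1) (Gaussian.*-identityˡ (G.fromℕ l)))
  where
  q₁q₂≡1 : q₁ G.* q₂ ≡ G.1#
  q₁q₂≡1 = Gaussian.*-fromℕ-cancel 0<l (trans (Gaussian.*-assoc q₁ q₂ _) (trans (cong (q₁ G.*_) q₂l≡x) q₁x≡l))
  0<re-q₂ : 0ℤ ℤ.< re q₂
  0<re-q₂ = ℤP.*-cancelʳ-<-nonNeg (ℤ.+ l)
    (subst (0ℤ ℤ.<_) (trans (cong re (sym q₂l≡x)) (Gaussian.re-*-fromℕ q₂ l)) 0<re-x)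
  q₂≡1 : q₂ ≡ G.1#
  q₂≡1 = Gaussian.unit-rePositive⇒1# {w = q₁} q₁q₂≡1 0<re-q₂

mainTheorem17 : (R : Ring) (n : ℕ) (A : Mat R n) (l : ℕ) (α : Fin n → Carrier R)
    → IsIcube R A l → IsSNF R A α
    → ∀ (j : Fin n) → mul R (conj R (α j)) (α (opposite j)) ≡ ι R l
mainTheorem17 R n A l α
  (0<l , GramA≐λI) ((P , Q , (P′ , PP′≐I , P′P≐I) , (Q′ , QQ′≐I , Q′Q≐I) , A≐PDQ) , step , normalized) j =
  associated-rePositive⇒≡ R 0<l (conj-*-rePositive R (normalized j) (normalized (opposite j)))
    (corner-products-associated α (divisor-chain α (λ r s → ∣R⇒∣ ∘ step r s)) (ι R l)
      (Smith-Gram-identity α (ι R l) A≐PDQ QQ′≐I GramA≐λI)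
      (Gram-inverse PP′≐I P′P≐I) (Gram-inverse Q′Q≐I QQ′≐I) j)
  where open Theory R
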